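{- Let $1\le t\le n$ and let $H: a_1x_1+\cdots+a_tx_t=b$ be a spanned hyperplane of $Q_n$, where $a_1,\dots,a_t,b$ are positive integers with $a_1\le a_2\le\cdots\le a_t$. Let $\alpha=(\alpha_1,\dots,\alpha_\ell)$ be the type of $H$. Then $$F(H)=P(H)\times B_{n,t},$$ where $P(H)=S_\alpha$ if $\sum_{i=1}^t a_i\neq 2b$ and $P(H)=S_\alpha\cup\overline{S}_\alpha$ if $\sum_{i=1}^t a_i=2b$, and $B_{n,t}$ is the group of all signed permutations of $\{t+1,\dots,n\}$.
   Context: $Q_n=[0,1]^n$, $V_n=\{0,1\}^n$. $B_n$ is the group of signed permutations $w$ of $\{1,\dots,n\}$ (underlying permutation $\pi$, sign $\pm$ on each $i$), acting on $\mathbb{R}^n$ by $w(x)_i=x_{\pi(i)}$ if $i$ has sign $+$ and $w(x)_i=1-x_{\pi(i)}$ if $i$ has sign $-$; $w$ acts on hyperplanes by taking images. A spanned hyperplane of $Q_n$ is a hyperplane $H$ such that the affine hull of $H\cap V_n$ is $H$, and $F(H)=\{w\in B_n:w(H)=H\}$. The type of $H$ is $\alpha=(\alpha_1,\dots,\alpha_\ell)$ with $\ell=a_t$, where $\alpha_i$ is the number of indices $j$ with $a_j=i$ (so $\alpha_i$ may be $0$). With $\alpha_0=0$, let $I_i=[\alpha_1+\cdots+\alpha_{i-1}+1,\ \alpha_1+\cdots+\alpha_i]$ for $1\le i\le\ell$; these intervals partition $\{1,\dots,t\}$. $S_\alpha=S_{\alpha_1}\times\cdots\times S_{\alpha_\ell}$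 is the Young subgroup of permutations of $\{1,\dots,t\}$ preserving each $I_i$, viewed as signed permutations with all signs $+$; $\overline{S}_\alpha$ is the set of signed permutations of $\{1,\dots,t\}$ whose underlying permutation lies in $S_\alpha$ and in which every element has sign $-$. The product $P(H)\times B_{n,t}$ is the set of signed permutations of $\{1,\dots,n\}$ obtained by combining an element of $P(H)$ on $\{1,\dots,t\}$ with an element of $B_{n,t}$ on $\{t+1,\dots,n\}$.
   Formalization: The hyperplane H is taken in ℚⁿ rather than ℝⁿ, so the affine hull of H ∩ V_n uses rational weights and the condition w(H)=H is tested on points with rational coordinates. -}

module Defs where

open import Data.Nat as ℕ using (ℕ; zero; suc; _≤_; _<_; z≤n; s≤s)
open import Data.Fin as Fin using (Fin; toℕ; inject≤)
open import Data.Fin.Permutation using (Permutation′; _⟨$⟩ʳ_)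
open import Data.Vec as Vec using (Vec; lookup; tabulate)
open import Data.List as List using (List; []; _∷_; allFin; filter; length; map)
open import Data.List.Relation.Unary.All using (All)
open import Data.Rational as ℚ using (ℚ; 0ℚ; 1ℚ)
open import Data.Integer using (+_)
open import Data.Sign using (Sign)
open import Data.Bool using (Bool; true; false)
open import Data.Product using (Σ; _×_; _,_)
open import Data.Sum using (_⊎_)
open import Data.Empty using (⊥)
open import Relation.Binary.PropositionalEquality using (_≡_)

-- Points of ℝⁿ are represented by points of ℚⁿ.
Pt : ℕ → Set
Pt n = Vec ℚ n

ℕtoℚ : ℕ → ℚ
ℕtoℚ k = + k ℚ./ 1

sumℚ : List ℚ → ℚ
sumℚ = List.foldr ℚ._+_ 0ℚ

sumℕ : List ℕ → ℕ
sumℕ = List.foldr ℕ._+_ 0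

Subset : ℕ → Set₁
Subset n = Pt n → Set

-- the hyperplane  a₁x₁ + ⋯ + a_t x_t = b  in ℚⁿ  (t ≤ n, coordinates 0-based)
linForm : ∀ {n t} → t ≤ n → (Fin t → ℕ) → Pt n → ℚ
linForm {t = t} t≤n a x =
  sumℚ (map (λ k → ℕtoℚ (a k) ℚ.* lookup x (inject≤ k t≤n)) (allFin t))

hyperplane : ∀ {n t} → t ≤ n → (Fin t → ℕ) → ℕ → Subset n
hyperplane t≤n a b x = linForm t≤n a x ≡ ℕtoℚ b

vertex : ∀ {n} → Vec Bool n → Pt n
vertex = Vec.map (λ { true → 1ℚ ; false → 0ℚ })

combo : ∀ {n} → List (ℚ × Vec Bool n) → Pt n
combo {n} [] = Vec.replicate n 0ℚ
combo ((c , p) ∷ ps) = Vec.zipWith ℚ._+_ (Vec.map (c ℚ.*_) (vertex p)) (combo ps)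

weights : ∀ {n} → List (ℚ × Vec Bool n) → ℚ
weights ps = sumℚ (map (λ { (c , _) → c }) ps)

InAffHullVert : ∀ {n} → Subset n → Pt n → Set
InAffHullVert {n} S y =
  Σ (List (ℚ × Vec Bool n)) λ ps →
    All (λ { (_ , p) → S (vertex p) }) ps × weights ps ≡ 1ℚ × combo ps ≡ y

-- H is spanned: aff(H ∩ V_n) = H
Spanned : ∀ {n} → Subset n → Set
Spanned H = (∀ y → H y → InAffHullVert H y) × (∀ y → InAffHullVert H y → H y)

SignedPerm : ℕ → Set
SignedPerm n = Permutation′ n × (Fin n → Sign)

act : ∀ {n} → SignedPerm n → Pt n → Pt n
act (π , s) x = tabulate λ i → f (s i) (lookup x (π ⟨$⟩ʳ i))
  where
  f : Sign → ℚ → ℚ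
  f Sign.+ q = q
  f Sign.- q = 1ℚ ℚ.- q

Fixes : ∀ {n} → SignedPerm n → Subset n → Set
Fixes w H = (∀ x → H x → H (act w x))
          × (∀ y → H y → Σ (Pt _) λ x → H x × act w x ≡ y)

-- type of H: αⱼ = #{k : a_k = j};  ℓ = a_t
α : ∀ {t} → (Fin t → ℕ) → ℕ → ℕ
α {t} a j = length (filter (λ k → a k ℕ.≟ j) (allFin t))

prefα : ∀ {t} → (Fin t → ℕ) → ℕ → ℕ
prefα a zero = 0
prefα a (suc j) = prefα a j ℕ.+ α a (suc j)

lastIdx : ∀ {t} → 1 ≤ t → Fin t
lastIdx {suc t} _ = Fin.fromℕ t

ℓ : ∀ {t} → 1 ≤ t → (Fin t → ℕ) → ℕ
ℓ 1≤t a = a (lastIdx 1≤t)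

-- 0-based position k lies in I_j = [α₁+⋯+α_{j-1}+1, α₁+⋯+αⱼ] (1-based)
InI : ∀ {t} → (Fin t → ℕ) → ℕ → ℕ → Set
InI a (suc j) k = prefα a j ≤ k × k < prefα a (suc j)
InI a zero k = ⊥   -- j = 0 is not an index (never used)

InPB : ∀ {n t} → t ≤ n → 1 ≤ t → (Fin t → ℕ) → ℕ → SignedPerm n → Set
InPB {n} {t} t≤n 1≤t a b (π , s) =
  -- underlying permutation restricted to {1..t} lies in S_α
  (∀ j → 1 ≤ j → j ≤ ℓ 1≤t a → ∀ (i : Fin t) →
      InI a j (toℕ i) → InI a j (toℕ (π ⟨$⟩ʳ inject≤ i t≤n)))
  -- and maps {t+1..n} into itself (element of B_{n,t} there, signs free)
  × (∀ (i : Fin n) → t ≤ toℕ i → t ≤ toℕ (π ⟨$⟩ʳ i))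
  -- signs on {1..t}: all + (S_α), or, only when Σ aᵢ = 2b, all - (S̄_α)
  × ( (∀ (i : Fin t) → s (inject≤ i t≤n) ≡ Sign.+)
    ⊎ (sumℕ (map a (allFin t)) ≡ 2 ℕ.* b × (∀ (i : Fin t) → s (inject≤ i t≤n) ≡ Sign.-)))

module Submission where

-- Write ℓ(x) = a₁x₁ + ⋯ + a_t x_t, so H = {ℓ = b}, and let c : Fin n → ℕ be the
-- coefficient vector of ℓ (c_m = a_k at the k-th coordinate, 0 beyond t).  A
-- signed permutation w = (π, s) acts by x ↦ x or x ↦ 1 − x in each coordinate,
-- so ℓ ∘ w is affine in each coordinate, with slope c(π⁻¹ m)·(±1) in coordinate m.
-- Two general facts about such coordinatewise affine functions drive the proof:
--   * if g equals B on the nonempty level set {f = B}, the slopes of g are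
--     proportional to those of f (probe {f = B} by two coordinate moves);
--   * a relation g = K + λ·f that holds at one point and is obeyed by the slopes
--     holds everywhere (every point is reached by coordinate updates).
-- Forward: proportionality gives c ∘ π⁻¹ = κ·c; comparing the least positive and
-- the largest coefficient forces κ = 1, and the signs on {1..t} are then equal
-- to a single ε.  Given c ∘ π = c and constant sign ε, the second fact yields the
-- conjugation formula ℓ(w x) = offset ε + ε·ℓ(x), so w fixes H iff
-- offset ε + ε·b = b, i.e. iff ε = + or Σ aᵢ = 2b.  Finally, for sorted positive
-- a the block I_j is exactly the set of positions where a equals j, so "π keeps
-- every I_j and {t+1..n}" is again c ∘ π = c.

open import Defs
open import Data.Nat as ℕ using (ℕ; zero; suc; _≤_; _<_; z≤n; s≤s)
import Data.Nat.Properties as ℕP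
open import Data.Fin as Fin using (Fin; toℕ; inject≤) renaming (_≤_ to _≤ᶠ_)
import Data.Fin.Properties as FinP
open import Data.Fin.Permutation using (Permutation′; _⟨$⟩ʳ_; _⟨$⟩ˡ_; inverseˡ; inverseʳ; flip)
open import Data.Vec as Vec using (lookup; tabulate; _[_]≔_)
import Data.Vec.Properties as VecP
open import Data.List as List using (List; []; _∷_; allFin; filter; length; map)
import Data.List.Properties as ListP
open import Data.List.Membership.Propositional using (_∈_)
open import Data.List.Membership.Propositional.Properties using (∈-allFin)
import Data.List.Relation.Unary.Any as Any
open import Data.Integer as ℤ using (+_)
import Data.Integer.Properties as ℤP
open import Data.Rational as ℚ using (ℚ; 0ℚ; 1ℚ; mkℚ)
import Data.Rational.Properties as ℚP
open import Data.Rational.Solver using (module +-*-Solver)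
import Data.Nat.Coprimality as Coprimality
open import Data.Sign as Sign using (Sign)
open import Data.Bool using (true; false; if_then_else_; T)
open import Data.Unit using (tt)
open import Data.Empty using (⊥-elim)
open import Data.Product using (Σ; _×_; _,_; proj₁; proj₂; uncurry)
open import Data.Sum using (_⊎_; inj₁; inj₂; [_,_]′)
open import Relation.Nullary using (¬_; yes; no)
open import Relation.Unary using (Decidable)
open import Relation.Binary.PropositionalEquality
open import Function.Base using (_∘_; _∋_)
open import Function.Bundles using (_⇔_; mk⇔)
import Function.Properties.Equivalence as Equivalence

open +-*-Solver using (solve; _:+_; _:*_; _:-_; :-_; _:=_; con)
open ≡-Reasoning

ℕtoℚ-mkℚ : ∀ k → ℕtoℚ k ≡ mkℚ (+ k) 0 (Coprimality.sym (Coprimality.1-coprimeTo k))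
ℕtoℚ-mkℚ k = ℚP.normalize-coprime (Coprimality.sym (Coprimality.1-coprimeTo k))

ℕtoℚ-injective : ∀ {x y} → ℕtoℚ x ≡ ℕtoℚ y → x ≡ y
ℕtoℚ-injective {x} {y} e = ℤP.+-injective (begin
  + x           ≡⟨ cong ℚ.↥_ (ℕtoℚ-mkℚ x) ⟨
  ℚ.↥ ℕtoℚ x    ≡⟨ cong ℚ.↥_ e ⟩
  ℚ.↥ ℕtoℚ y    ≡⟨ cong ℚ.↥_ (ℕtoℚ-mkℚ y) ⟩
  + y           ∎)

-- Both operations act on numerators over the common denominator 1.
ℕtoℚ-+ : ∀ x y → ℕtoℚ (x ℕ.+ y) ≡ ℕtoℚ x ℚ.+ ℕtoℚ y
ℕtoℚ-+ x y = trans (cong (ℚ._/ 1) numerators) (sym (cong₂ ℚ._+_ (ℕtoℚ-mkℚ x) (ℕtoℚ-mkℚ y)))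
  where
  numerators : + (x ℕ.+ y) ≡ + x ℤ.* + 1 ℤ.+ + y ℤ.* + 1
  numerators = trans (ℤP.pos-+ x y) (sym (cong₂ ℤ._+_ (ℤP.*-identityʳ (+ x)) (ℤP.*-identityʳ (+ y))))

ℕtoℚ-* : ∀ x y → ℕtoℚ (x ℕ.* y) ≡ ℕtoℚ x ℚ.* ℕtoℚ y
ℕtoℚ-* x y = trans (cong (ℚ._/ 1) (ℤP.pos-* x y)) (sym (cong₂ ℚ._*_ (ℕtoℚ-mkℚ x) (ℕtoℚ-mkℚ y)))

-- Stated once, so that no later proof has to identify ℕtoℚ 0 with 0ℚ by evaluation.
ℕtoℚ-zero : ℕtoℚ 0 ≡ 0ℚ
ℕtoℚ-zero = refl

ℕtoℚ-double : ∀ b → ℕtoℚ (2 ℕ.* b) ≡ ℕtoℚ b ℚ.+ ℕtoℚ b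
ℕtoℚ-double b = trans (ℕtoℚ-+ b (b ℕ.+ 0)) (cong (λ k → ℕtoℚ b ℚ.+ ℕtoℚ k) (ℕP.+-identityʳ b))

ℕtoℚ-sum-zero : ∀ X Y → ℕtoℚ X ℚ.+ ℕtoℚ Y ≡ 0ℚ → X ≡ 0 × Y ≡ 0
ℕtoℚ-sum-zero X Y e = ℕP.m+n≡0⇒m≡0 X X+Y≡0 , ℕP.m+n≡0⇒n≡0 X X+Y≡0
  where
  X+Y≡0 : X ℕ.+ Y ≡ 0
  X+Y≡0 = ℕtoℚ-injective (trans (ℕtoℚ-+ X Y) (trans e (sym ℕtoℚ-zero)))

signMap : Sign → ℚ → ℚ
signMap Sign.+ q = q
signMap Sign.- q = 1ℚ ℚ.- q

signSlope : Sign → ℚ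
signSlope Sign.+ = 1ℚ
signSlope Sign.- = ℚ.- 1ℚ

signMap-diff : ∀ σ p q → signMap σ p ℚ.- signMap σ q ≡ signSlope σ ℚ.* (p ℚ.- q)
signMap-diff Sign.+ = solve 2 (λ p q → p :- q := con 1ℚ :* (p :- q)) refl
signMap-diff Sign.- = solve 2 (λ p q → (con 1ℚ :- p) :- (con 1ℚ :- q) := (:- con 1ℚ) :* (p :- q)) refl

signMap-involutive : ∀ σ q → signMap σ (signMap σ q) ≡ q
signMap-involutive Sign.+ q = refl
signMap-involutive Sign.- = solve 1 (λ q → con 1ℚ :- (con 1ℚ :- q) := q) refl

-- The affine map u ↦ K + (±1)·u is injective: (±1)·((K + (±1)·u) − K) = u.
signAffine-injective : ∀ σ K u v → K ℚ.+ signSlope σ ℚ.* u ≡ K ℚ.+ signSlope σ ℚ.* v → u ≡ v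
signAffine-injective σ K u v e = begin
  u                                                  ≡⟨ recover σ u ⟨
  signSlope σ ℚ.* ((K ℚ.+ signSlope σ ℚ.* u) ℚ.- K)  ≡⟨ cong (λ y → signSlope σ ℚ.* (y ℚ.- K)) e ⟩
  signSlope σ ℚ.* ((K ℚ.+ signSlope σ ℚ.* v) ℚ.- K)  ≡⟨ recover σ v ⟩
  v                                                  ∎
  where
  recover : ∀ σ r → signSlope σ ℚ.* ((K ℚ.+ signSlope σ ℚ.* r) ℚ.- K) ≡ r
  recover Sign.+ = solve 2 (λ K r → con 1ℚ :* ((K :+ con 1ℚ :* r) :- K) := r) refl K
  recover Sign.- = solve 2 (λ K r → (:- con 1ℚ) :* ((K :+ (:- con 1ℚ) :* r) :- K) := r) refl K

signSlope-cancel : ∀ σ p q → p ℚ.* signSlope σ ≡ q ℚ.* signSlope σ → p ≡ q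
signSlope-cancel σ p q e =
  signAffine-injective σ 0ℚ p q (cong (0ℚ ℚ.+_) (trans (ℚP.*-comm (signSlope σ) p) (trans e (ℚP.*-comm q (signSlope σ)))))

opposite-signs-sum : ∀ p q → p ℚ.* 1ℚ ≡ q ℚ.* (ℚ.- 1ℚ) → p ℚ.+ q ≡ 0ℚ
opposite-signs-sum p q e = begin
  p ℚ.+ q                                  ≡⟨ solve 2 (λ p q → p :+ q := p :* con 1ℚ :- q :* (:- con 1ℚ)) refl p q ⟩
  p ℚ.* 1ℚ ℚ.- q ℚ.* (ℚ.- 1ℚ)              ≡⟨ cong (ℚ._- q ℚ.* (ℚ.- 1ℚ)) e ⟩
  q ℚ.* (ℚ.- 1ℚ) ℚ.- q ℚ.* (ℚ.- 1ℚ)        ≡⟨ ℚP.+-inverseʳ (q ℚ.* (ℚ.- 1ℚ)) ⟩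
  0ℚ                                       ∎

signed-injective : ∀ X Y σ τ → ℕtoℚ X ℚ.* signSlope σ ≡ ℕtoℚ Y ℚ.* signSlope τ →
  X ≡ Y × (X ≡ 0 ⊎ σ ≡ τ)
signed-injective X Y Sign.+ Sign.+ e = ℕtoℚ-injective (signSlope-cancel Sign.+ (ℕtoℚ X) (ℕtoℚ Y) e) , inj₂ refl
signed-injective X Y Sign.- Sign.- e = ℕtoℚ-injective (signSlope-cancel Sign.- (ℕtoℚ X) (ℕtoℚ Y) e) , inj₂ refl
signed-injective X Y Sign.+ Sign.- e = trans (proj₁ zeros) (sym (proj₂ zeros)) , inj₁ (proj₁ zeros)
  where zeros = ℕtoℚ-sum-zero X Y (opposite-signs-sum (ℕtoℚ X) (ℕtoℚ Y) e)
signed-injective X Y Sign.- Sign.+ e = trans (proj₂ zeros) (sym (proj₁ zeros)) , inj₁ (proj₂ zeros)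
  where zeros = ℕtoℚ-sum-zero Y X (opposite-signs-sum (ℕtoℚ Y) (ℕtoℚ X) (sym e))

-- Coordinate updates reach every point

AgreeOff : ∀ {n} → Fin n → Pt n → Pt n → Set
AgreeOff m x x' = ∀ j → j ≢ m → lookup x' j ≡ lookup x j

update-agreeOff : ∀ {n} (x : Pt n) m q → AgreeOff m x (x [ m ]≔ q)
update-agreeOff x m q j j≢m = VecP.lookup∘update′ j≢m x q

pointwise-≡ : ∀ {n} {u v : Pt n} → (∀ j → lookup u j ≡ lookup v j) → u ≡ v
pointwise-≡ {u = u} {v} h = trans (sym (VecP.tabulate∘lookup u)) (trans (VecP.tabulate-cong h) (VecP.tabulate∘lookup v))

overwrite : ∀ {n} → List (Fin n) → Pt n → Pt n → Pt n
overwrite []       y x = x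
overwrite (m ∷ ms) y x = overwrite ms y x [ m ]≔ lookup y m

overwrite-lookup : ∀ {n} ms (y x : Pt n) j → j ∈ ms → lookup (overwrite ms y x) j ≡ lookup y j
overwrite-lookup (m ∷ ms) y x j j∈ with j FinP.≟ m
... | yes refl = VecP.lookup∘update j (overwrite ms y x) (lookup y j)
... | no j≢m   = trans (update-agreeOff (overwrite ms y x) m (lookup y m) j j≢m) (overwrite-lookup ms y x j (Any.tail j≢m j∈))

update-induction : ∀ {n} (Q : Pt n → Set) → (∀ x m q → Q x → Q (x [ m ]≔ q)) →
  ∀ x₀ → Q x₀ → ∀ y → Q y
update-induction {n} Q step x₀ Qx₀ y =
  subst Q (pointwise-≡ λ j → overwrite-lookup (allFin n) y x₀ j (∈-allFin j)) (reach (allFin n))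
  where
  reach : ∀ ms → Q (overwrite ms y x₀)
  reach []       = Qx₀
  reach (m ∷ ms) = step _ m _ (reach ms)

-- Functions that are affine in each coordinate

record HasSlopes {n} (f : Pt n → ℚ) (d : Fin n → ℚ) : Set where
  constructor hasSlopes
  field
    change : ∀ m (x x' : Pt n) → AgreeOff m x x' → f x' ≡ f x ℚ.+ d m ℚ.* (lookup x' m ℚ.- lookup x m)
open HasSlopes

slope-update : ∀ {n f d} → HasSlopes {n} f d → ∀ x m q →
  f (x [ m ]≔ q) ≡ f x ℚ.+ d m ℚ.* (q ℚ.- lookup x m)
slope-update {f = f} {d} hf x m q = trans (change hf m x _ (update-agreeOff x m q))
  (cong (λ u → f x ℚ.+ d m ℚ.* (u ℚ.- lookup x m)) (VecP.lookup∘update m x q))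

twoMoves : ∀ {n} → Pt n → Fin n → Fin n → ℚ → ℚ → Pt n
twoMoves x z m u v = x₁ [ m ]≔ (lookup x₁ m ℚ.- v)
  where x₁ = x [ z ]≔ (lookup x z ℚ.+ u)

twoMoves-value : ∀ {n f d} → HasSlopes {n} f d → ∀ x z m u v →
  f (twoMoves x z m u v) ≡ f x ℚ.+ (d z ℚ.* u ℚ.- d m ℚ.* v)
twoMoves-value {f = f} {d} hf x z m u v = begin
  f (twoMoves x z m u v)                                  ≡⟨ slope-update hf x₁ m _ ⟩
  f x₁ ℚ.+ d m ℚ.* ((r ℚ.- v) ℚ.- r)
    ≡⟨ cong (ℚ._+ d m ℚ.* ((r ℚ.- v) ℚ.- r)) (slope-update hf x z _) ⟩
  (f x ℚ.+ d z ℚ.* ((p ℚ.+ u) ℚ.- p)) ℚ.+ d m ℚ.* ((r ℚ.- v) ℚ.- r)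
    ≡⟨ solve 7 (λ F a p u b r v → (F :+ a :* ((p :+ u) :- p)) :+ b :* ((r :- v) :- r) := F :+ (a :* u :- b :* v))
             refl (f x) (d z) p u (d m) r v ⟩
  f x ℚ.+ (d z ℚ.* u ℚ.- d m ℚ.* v)                       ∎
  where
  x₁ = x [ z ]≔ (lookup x z ℚ.+ u)
  p = lookup x z
  r = lookup x₁ m

-- If g takes the value B on the nonempty level set {f = B}, the slopes of g are
-- proportional to those of f.  Probe: moving by d m in z and by −d z in m stays in {f = B}.
level-set-slopes : ∀ {n f d g e} → HasSlopes {n} f d → HasSlopes g e → ∀ B →
  (∀ x → f x ≡ B → g x ≡ B) → ∀ x₀ → f x₀ ≡ B → ∀ z m → e z ℚ.* d m ≡ e m ℚ.* d z
level-set-slopes {f = f} {d} {g} {e} hf hg B level x₀ fx₀ z m = difference-zero (begin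
  B                                           ≡⟨ level x₂ fx₂ ⟨
  g x₂                                        ≡⟨ twoMoves-value hg x₀ z m (d m) (d z) ⟩
  g x₀ ℚ.+ (e z ℚ.* d m ℚ.- e m ℚ.* d z)      ≡⟨ cong (ℚ._+ (e z ℚ.* d m ℚ.- e m ℚ.* d z)) (level x₀ fx₀) ⟩
  B ℚ.+ (e z ℚ.* d m ℚ.- e m ℚ.* d z)         ∎)
  where
  x₂ = twoMoves x₀ z m (d m) (d z)
  fx₂ : f x₂ ≡ B
  fx₂ = begin
    f x₂                                    ≡⟨ twoMoves-value hf x₀ z m (d m) (d z) ⟩
    f x₀ ℚ.+ (d z ℚ.* d m ℚ.- d m ℚ.* d z)  ≡⟨ solve 3 (λ F a b → F :+ (a :* b :- b :* a) := F) refl (f x₀) (d z) (d m) ⟩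
    f x₀                                    ≡⟨ fx₀ ⟩
    B                                       ∎
  difference-zero : ∀ {p q} → B ≡ B ℚ.+ (p ℚ.- q) → p ≡ q
  difference-zero {p} {q} h = begin
    p                               ≡⟨ solve 3 (λ B p q → p := ((B :+ (p :- q)) :- B) :+ q) refl B p q ⟩
    ((B ℚ.+ (p ℚ.- q)) ℚ.- B) ℚ.+ q ≡⟨ cong (λ y → (y ℚ.- B) ℚ.+ q) h ⟨
    (B ℚ.- B) ℚ.+ q                 ≡⟨ solve 2 (λ B q → (B :- B) :+ q := q) refl B q ⟩
    q                               ∎

affine-relation : ∀ {n f d g e} → HasSlopes {n} f d → HasSlopes g e → ∀ K c →
  (∀ m → e m ≡ c ℚ.* d m) → ∀ x₀ → g x₀ ≡ K ℚ.+ c ℚ.* f x₀ → ∀ x → g x ≡ K ℚ.+ c ℚ.* f x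
affine-relation {f = f} {d} {g} {e} hf hg K c slopes = update-induction (λ x → g x ≡ K ℚ.+ c ℚ.* f x) step
  where
  step : ∀ x m q → g x ≡ K ℚ.+ c ℚ.* f x → g (x [ m ]≔ q) ≡ K ℚ.+ c ℚ.* f (x [ m ]≔ q)
  step x m q rel = begin
    g (x [ m ]≔ q)                                  ≡⟨ slope-update hg x m q ⟩
    g x ℚ.+ e m ℚ.* δ                               ≡⟨ cong₂ (λ y k → y ℚ.+ k ℚ.* δ) rel (slopes m) ⟩
    (K ℚ.+ c ℚ.* f x) ℚ.+ (c ℚ.* d m) ℚ.* δ
      ≡⟨ solve 5 (λ K c F a δ → (K :+ c :* F) :+ (c :* a) :* δ := K :+ c :* (F :+ a :* δ)) refl K c (f x) (d m) δ ⟩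
    K ℚ.+ c ℚ.* (f x ℚ.+ d m ℚ.* δ)                 ≡⟨ cong (λ y → K ℚ.+ c ℚ.* y) (slope-update hf x m q) ⟨
    K ℚ.+ c ℚ.* f (x [ m ]≔ q)                      ∎
    where δ = q ℚ.- lookup x m

-- The action of signed permutations

-- The first `with` generalises the looked-up entry, so that splitting on the
-- sign can then reduce the tabulated expression.
act-lookup : ∀ {n} (π : Permutation′ n) s (x : Pt n) i →
  lookup (act (π , s) x) i ≡ signMap (s i) (lookup x (π ⟨$⟩ʳ i))
act-lookup π s x i
  with lookup (act (π , s) x) i | (lookup (act (π , s) x) i ≡ _) ∋ VecP.lookup∘tabulate _ i
... | _ | e with s i
...   | Sign.+ = e
...   | Sign.- = e

act-inverse : ∀ {n} → SignedPerm n → Pt n → Pt n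
act-inverse (π , s) y = tabulate λ m → signMap (s (π ⟨$⟩ˡ m)) (lookup y (π ⟨$⟩ˡ m))

act-inverse-right : ∀ {n} (w : SignedPerm n) y → act w (act-inverse w y) ≡ y
act-inverse-right (π , s) y = pointwise-≡ λ i → begin
  lookup (act (π , s) (act-inverse (π , s) y)) i                      ≡⟨ act-lookup π s (act-inverse (π , s) y) i ⟩
  signMap (s i) (lookup (act-inverse (π , s) y) (π ⟨$⟩ʳ i))
    ≡⟨ cong (signMap (s i)) (VecP.lookup∘tabulate _ (π ⟨$⟩ʳ i)) ⟩
  signMap (s i) (signMap (s (P (π ⟨$⟩ʳ i))) (lookup y (P (π ⟨$⟩ʳ i))))
    ≡⟨ cong (λ j → signMap (s i) (signMap (s j) (lookup y j))) (inverseˡ π) ⟩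
  signMap (s i) (signMap (s i) (lookup y i))                          ≡⟨ signMap-involutive (s i) (lookup y i) ⟩
  lookup y i                                                          ∎
  where P = π ⟨$⟩ˡ_

act-slopes : ∀ {n f d} (π : Permutation′ n) s → HasSlopes f d →
  HasSlopes (λ x → f (act (π , s) x)) (λ m → d (π ⟨$⟩ˡ m) ℚ.* signSlope (s (π ⟨$⟩ˡ m)))
act-slopes {n} {f} {d} π s hf = hasSlopes changed
  where
  P = π ⟨$⟩ˡ_
  changed : ∀ m (x x' : Pt n) → AgreeOff m x x' →
    f (act (π , s) x') ≡ f (act (π , s) x) ℚ.+ (d (P m) ℚ.* signSlope (s (P m))) ℚ.* (lookup x' m ℚ.- lookup x m)
  changed m x x' agree = begin
    f wx'                                                     ≡⟨ change hf (P m) wx wx' agree′ ⟩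
    f wx ℚ.+ d (P m) ℚ.* (lookup wx' (P m) ℚ.- lookup wx (P m)) ≡⟨ cong (λ y → f wx ℚ.+ d (P m) ℚ.* y) difference ⟩
    f wx ℚ.+ d (P m) ℚ.* (σ ℚ.* δ)                            ≡⟨ cong (f wx ℚ.+_) (ℚP.*-assoc (d (P m)) σ δ) ⟨
    f wx ℚ.+ (d (P m) ℚ.* σ) ℚ.* δ                            ∎
    where
    wx = act (π , s) x
    wx' = act (π , s) x'
    σ = signSlope (s (P m))
    δ = lookup x' m ℚ.- lookup x m
    agree′ : AgreeOff (P m) wx wx'
    agree′ j j≢Pm = trans (act-lookup π s x' j)
      (trans (cong (signMap (s j)) (agree (π ⟨$⟩ʳ j) λ πj≡m → j≢Pm (trans (sym (inverseˡ π)) (cong P πj≡m))))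
             (sym (act-lookup π s x j)))
    difference : lookup wx' (P m) ℚ.- lookup wx (P m) ≡ σ ℚ.* δ
    difference = begin
      lookup wx' (P m) ℚ.- lookup wx (P m)
        ≡⟨ cong₂ ℚ._-_ (act-lookup π s x' (P m)) (act-lookup π s x (P m)) ⟩
      signMap (s (P m)) (lookup x' (π ⟨$⟩ʳ P m)) ℚ.- signMap (s (P m)) (lookup x (π ⟨$⟩ʳ P m))
        ≡⟨ cong (λ j → signMap (s (P m)) (lookup x' j) ℚ.- signMap (s (P m)) (lookup x j)) (inverseʳ π) ⟩
      signMap (s (P m)) (lookup x' m) ℚ.- signMap (s (P m)) (lookup x m)
        ≡⟨ signMap-diff (s (P m)) (lookup x' m) (lookup x m) ⟩
      σ ℚ.* δ ∎

-- A permutation cannot rescale a coefficient vector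

-- If c(g z)·c m = c(g m)·c z for all m, i.e. c ∘ g = κ·c with κ = c(g z)/c z,
-- where z carries the least positive value and L the largest, then κ = 1:
-- c(g z) is positive, hence ≥ c z, and c(g z)·c L = c(g L)·c z ≤ c L·c z.
rescaling-is-trivial : ∀ {n} (c : Fin n → ℕ) (g : Permutation′ n) (z L : Fin n) →
  1 ≤ c z → (∀ m → 1 ≤ c m → c z ≤ c m) → (∀ m → c m ≤ c L) →
  (∀ m → c (g ⟨$⟩ʳ z) ℕ.* c m ≡ c (g ⟨$⟩ʳ m) ℕ.* c z) → ∀ m → c (g ⟨$⟩ʳ m) ≡ c m
rescaling-is-trivial c g z L cz≥1 z-least L-largest ratio m =
  ℕP.*-cancelʳ-≡ (c (g ⟨$⟩ʳ m)) (c m) (c z) (begin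
    c (g ⟨$⟩ʳ m) ℕ.* c z   ≡⟨ ratio m ⟨
    c gz ℕ.* c m           ≡⟨ cong (ℕ._* c m) gz≡z ⟩
    c z ℕ.* c m            ≡⟨ ℕP.*-comm (c z) (c m) ⟩
    c m ℕ.* c z            ∎)
  where
  gz = g ⟨$⟩ʳ z
  instance
    cz≢0 : ℕ.NonZero (c z)
    cz≢0 = ℕ.>-nonZero cz≥1
    cL≢0 : ℕ.NonZero (c L)
    cL≢0 = ℕ.>-nonZero (ℕP.≤-trans cz≥1 (L-largest z))
  -- c gz · c(g⁻¹ z) = c z · c z ≠ 0
  gz-positive : 1 ≤ c gz
  gz-positive = ℕP.n≢0⇒n>0 λ cgz≡0 → ℕP.<⇒≢ (ℕP.*-mono-≤ cz≥1 cz≥1) (sym (begin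
    c z ℕ.* c z                    ≡⟨ cong (λ j → c j ℕ.* c z) (inverseʳ g) ⟨
    c (g ⟨$⟩ʳ (g ⟨$⟩ˡ z)) ℕ.* c z  ≡⟨ ratio (g ⟨$⟩ˡ z) ⟨
    c gz ℕ.* c (g ⟨$⟩ˡ z)          ≡⟨ cong (ℕ._* c (g ⟨$⟩ˡ z)) cgz≡0 ⟩
    0                              ∎))
  -- c gz · c L = c(g L) · c z ≤ c z · c L
  gz≤z : c gz ≤ c z
  gz≤z = ℕP.*-cancelʳ-≤ (c gz) (c z) (c L)
    (ℕP.≤-trans (ℕP.≤-reflexive (ratio L))
    (ℕP.≤-trans (ℕP.*-monoˡ-≤ (c z) (L-largest (g ⟨$⟩ʳ L)))
                (ℕP.≤-reflexive (ℕP.*-comm (c L) (c z)))))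
  gz≡z : c gz ≡ c z
  gz≡z = ℕP.≤-antisym gz≤z (z-least gz gz-positive)

≡ᵇ-true : ∀ {x y} → (x ℕ.≡ᵇ y) ≡ true → x ≡ y
≡ᵇ-true {x} {y} e = ℕP.≡ᵇ⇒≡ x y (subst T (sym e) tt)

≡ᵇ-false : ∀ {x y} → (x ℕ.≡ᵇ y) ≡ false → x ≢ y
≡ᵇ-false {x} {y} e x≡y = subst T e (ℕP.≡⇒≡ᵇ x y x≡y)

≤ᵇ-true : ∀ {x y} → (x ℕ.≤ᵇ y) ≡ true → x ≤ y
≤ᵇ-true {x} {y} e = ℕP.≤ᵇ⇒≤ x y (subst T (sym e) tt)

≤ᵇ-false : ∀ {x y} → (x ℕ.≤ᵇ y) ≡ false → ¬ x ≤ y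
≤ᵇ-false e x≤y = subst T e (ℕP.≤⇒≤ᵇ x≤y)

sum-zeros : ∀ t → sumℕ (List.tabulate {n = t} (λ _ → 0)) ≡ 0
sum-zeros zero    = refl
sum-zeros (suc t) = sum-zeros t

indicator-sum : ∀ {t} (g : Fin t → ℕ) (k₀ : Fin t) →
  sumℕ (List.tabulate (λ k → if toℕ k ℕ.≡ᵇ toℕ k₀ then g k else 0)) ≡ g k₀
indicator-sum {suc t} g Fin.zero     = trans (cong (g Fin.zero ℕ.+_) (sum-zeros t)) (ℕP.+-identityʳ _)
indicator-sum {suc t} g (Fin.suc k₀) = indicator-sum (g ∘ Fin.suc) k₀

indicator-sum-miss : ∀ {t} (g : Fin t → ℕ) r → t ≤ r →
  sumℕ (List.tabulate (λ k → if toℕ k ℕ.≡ᵇ r then g k else 0)) ≡ 0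
indicator-sum-miss {zero}  g r       _         = refl
indicator-sum-miss {suc t} g (suc r) (s≤s t≤r) = indicator-sum-miss (g ∘ Fin.suc) r t≤r

-- The linear form ℓ(x) = a₁x₁ + ⋯ + a_t x_t on ℚⁿ and its coefficient vector

origin : ∀ n → Pt n
origin n = Vec.replicate n 0ℚ

module LinearForm {n t : ℕ} (t≤n : t ≤ n) (a : Fin t → ℕ) where

  form : Pt n → ℚ
  form = linForm t≤n a

  ι : Fin t → Fin n
  ι k = inject≤ k t≤n

  toℕ-ι : ∀ k → toℕ (ι k) ≡ toℕ k
  toℕ-ι k = FinP.toℕ-inject≤ k t≤n

  ι-onto : ∀ m → toℕ m < t → Σ (Fin t) λ k → ι k ≡ m
  ι-onto m m<t = Fin.fromℕ< m<t , FinP.toℕ-injective (trans (toℕ-ι _) (FinP.toℕ-fromℕ< m<t))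

  coordinate-view : ∀ m → Σ (Fin t) (λ k → ι k ≡ m) ⊎ t ≤ toℕ m
  coordinate-view m with toℕ m ℕ.<? t
  ... | yes m<t = inj₁ (ι-onto m m<t)
  ... | no  m≮t = inj₂ (ℕP.≮⇒≥ m≮t)

  partialForm : List (Fin t) → Pt n → ℚ
  partialForm ks x = sumℚ (map (λ k → ℕtoℚ (a k) ℚ.* lookup x (ι k)) ks)

  coeffIn : List (Fin t) → Fin n → ℕ
  coeffIn ks m = sumℕ (map (λ k → if toℕ k ℕ.≡ᵇ toℕ m then a k else 0) ks)

  coeff : Fin n → ℕ
  coeff = coeffIn (allFin t)

  summand-change : ∀ k m (x x' : Pt n) → AgreeOff m x x' →
    ℕtoℚ (a k) ℚ.* lookup x' (ι k)
      ≡ ℕtoℚ (a k) ℚ.* lookup x (ι k) ℚ.+ ℕtoℚ (if toℕ k ℕ.≡ᵇ toℕ m then a k else 0) ℚ.* (lookup x' m ℚ.- lookup x m)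
  summand-change k m x x' agree = by-test (toℕ k ℕ.≡ᵇ toℕ m) refl
    where
    A = ℕtoℚ (a k)
    δ = lookup x' m ℚ.- lookup x m
    by-test : ∀ hit → (toℕ k ℕ.≡ᵇ toℕ m) ≡ hit →
      A ℚ.* lookup x' (ι k) ≡ A ℚ.* lookup x (ι k) ℚ.+ ℕtoℚ (if hit then a k else 0) ℚ.* δ
    by-test true k≡ᵇm = begin
      A ℚ.* lookup x' (ι k)                       ≡⟨ cong (λ j → A ℚ.* lookup x' j) ιk≡m ⟩
      A ℚ.* lookup x' m
        ≡⟨ solve 3 (λ A X' X → A :* X' := A :* X :+ A :* (X' :- X)) refl A (lookup x' m) (lookup x m) ⟩
      A ℚ.* lookup x m ℚ.+ A ℚ.* δ                ≡⟨ cong (λ j → A ℚ.* lookup x j ℚ.+ A ℚ.* δ) ιk≡m ⟨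
      A ℚ.* lookup x (ι k) ℚ.+ A ℚ.* δ            ∎
      where
      ιk≡m : ι k ≡ m
      ιk≡m = FinP.toℕ-injective (trans (toℕ-ι k) (≡ᵇ-true {toℕ k} k≡ᵇm))
    by-test false k≢ᵇm = begin
      A ℚ.* lookup x' (ι k)                       ≡⟨ cong (A ℚ.*_) (agree (ι k) ιk≢m) ⟩
      A ℚ.* lookup x (ι k)                        ≡⟨ ℚP.+-identityʳ (A ℚ.* lookup x (ι k)) ⟨
      A ℚ.* lookup x (ι k) ℚ.+ 0ℚ                 ≡⟨ cong (A ℚ.* lookup x (ι k) ℚ.+_) (ℚP.*-zeroˡ δ) ⟨
      A ℚ.* lookup x (ι k) ℚ.+ 0ℚ ℚ.* δ           ≡⟨ cong (λ z → A ℚ.* lookup x (ι k) ℚ.+ z ℚ.* δ) ℕtoℚ-zero ⟨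
      A ℚ.* lookup x (ι k) ℚ.+ ℕtoℚ 0 ℚ.* δ       ∎
      where
      ιk≢m : ι k ≢ m
      ιk≢m ιk≡m = ≡ᵇ-false {toℕ k} k≢ᵇm (trans (sym (toℕ-ι k)) (cong toℕ ιk≡m))

  partialForm-change : ∀ ks m (x x' : Pt n) → AgreeOff m x x' →
    partialForm ks x' ≡ partialForm ks x ℚ.+ ℕtoℚ (coeffIn ks m) ℚ.* (lookup x' m ℚ.- lookup x m)
  partialForm-change [] m x x' _ = begin
    0ℚ
      ≡⟨ solve 1 (λ δ → con 0ℚ := con 0ℚ :+ con 0ℚ :* δ) refl (lookup x' m ℚ.- lookup x m) ⟩
    0ℚ ℚ.+ 0ℚ ℚ.* (lookup x' m ℚ.- lookup x m)
      ≡⟨ cong (λ z → 0ℚ ℚ.+ z ℚ.* (lookup x' m ℚ.- lookup x m)) ℕtoℚ-zero ⟨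
    0ℚ ℚ.+ ℕtoℚ 0 ℚ.* (lookup x' m ℚ.- lookup x m)  ∎
  partialForm-change (k ∷ ks) m x x' agree = begin
    A ℚ.* lookup x' (ι k) ℚ.+ partialForm ks x'
      ≡⟨ cong₂ ℚ._+_ (summand-change k m x x' agree) (partialForm-change ks m x x' agree) ⟩
    (A ℚ.* lookup x (ι k) ℚ.+ ℕtoℚ selected ℚ.* δ) ℚ.+ (partialForm ks x ℚ.+ ℕtoℚ (coeffIn ks m) ℚ.* δ)
      ≡⟨ solve 5 (λ F H S C δ → (F :+ H :* δ) :+ (S :+ C :* δ) := (F :+ S) :+ (H :+ C) :* δ) refl
           (A ℚ.* lookup x (ι k)) (ℕtoℚ selected) (partialForm ks x) (ℕtoℚ (coeffIn ks m)) δ ⟩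
    (A ℚ.* lookup x (ι k) ℚ.+ partialForm ks x) ℚ.+ (ℕtoℚ selected ℚ.+ ℕtoℚ (coeffIn ks m)) ℚ.* δ
      ≡⟨ cong (λ c → (A ℚ.* lookup x (ι k) ℚ.+ partialForm ks x) ℚ.+ c ℚ.* δ) (ℕtoℚ-+ selected (coeffIn ks m)) ⟨
    (A ℚ.* lookup x (ι k) ℚ.+ partialForm ks x) ℚ.+ ℕtoℚ (selected ℕ.+ coeffIn ks m) ℚ.* δ
      ∎
    where
    A = ℕtoℚ (a k)
    selected = if toℕ k ℕ.≡ᵇ toℕ m then a k else 0
    δ = lookup x' m ℚ.- lookup x m

  form-slopes : HasSlopes form (λ m → ℕtoℚ (coeff m))
  form-slopes = hasSlopes (partialForm-change (allFin t))

  coeff-ι : ∀ k → coeff (ι k) ≡ a k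
  coeff-ι k = begin
    coeff (ι k)
      ≡⟨ cong sumℕ (ListP.map-tabulate (λ k′ → k′) (λ k′ → if toℕ k′ ℕ.≡ᵇ toℕ (ι k) then a k′ else 0)) ⟩
    sumℕ (List.tabulate (λ k′ → if toℕ k′ ℕ.≡ᵇ toℕ (ι k) then a k′ else 0))
      ≡⟨ cong (λ r → sumℕ (List.tabulate (λ k′ → if toℕ k′ ℕ.≡ᵇ r then a k′ else 0))) (toℕ-ι k) ⟩
    sumℕ (List.tabulate (λ k′ → if toℕ k′ ℕ.≡ᵇ toℕ k then a k′ else 0))
      ≡⟨ indicator-sum a k ⟩
    a k ∎

  coeff-beyond : ∀ m → t ≤ toℕ m → coeff m ≡ 0
  coeff-beyond m beyond =
    trans (cong sumℕ (ListP.map-tabulate (λ k → k) (λ k → if toℕ k ℕ.≡ᵇ toℕ m then a k else 0)))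
          (indicator-sum-miss a (toℕ m) beyond)

  coeff-positive⇒ι : ∀ m → 1 ≤ coeff m → Σ (Fin t) λ k → ι k ≡ m
  coeff-positive⇒ι m positive with coordinate-view m
  ... | inj₁ found  = found
  ... | inj₂ beyond = ⊥-elim (ℕP.<⇒≢ positive (sym (coeff-beyond m beyond)))

  coeff-least : ∀ kmin → (∀ k → a kmin ≤ a k) → ∀ m → 1 ≤ coeff m → coeff (ι kmin) ≤ coeff m
  coeff-least kmin least m positive with coeff-positive⇒ι m positive
  ... | k , refl = subst₂ _≤_ (sym (coeff-ι kmin)) (sym (coeff-ι k)) (least k)

  coeff-largest : ∀ kmax → (∀ k → a k ≤ a kmax) → ∀ m → coeff m ≤ coeff (ι kmax)
  coeff-largest kmax largest m with coordinate-view m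
  ... | inj₁ (k , refl) = subst₂ _≤_ (sym (coeff-ι k)) (sym (coeff-ι kmax)) (largest k)
  ... | inj₂ beyond     = subst (_≤ coeff (ι kmax)) (sym (coeff-beyond m beyond)) z≤n

  total : ℕ
  total = sumℕ (map a (allFin t))

  partialForm-constant : ∀ ks x c → (∀ k → lookup x (ι k) ≡ c) →
    partialForm ks x ≡ ℕtoℚ (sumℕ (map a ks)) ℚ.* c
  partialForm-constant []       x c _        = trans (sym (ℚP.*-zeroˡ c)) (cong (ℚ._* c) (sym ℕtoℚ-zero))
  partialForm-constant (k ∷ ks) x c constant = begin
    ℕtoℚ (a k) ℚ.* lookup x (ι k) ℚ.+ partialForm ks x
      ≡⟨ cong₂ (λ u v → ℕtoℚ (a k) ℚ.* u ℚ.+ v) (constant k) (partialForm-constant ks x c constant) ⟩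
    ℕtoℚ (a k) ℚ.* c ℚ.+ ℕtoℚ (sumℕ (map a ks)) ℚ.* c
      ≡⟨ ℚP.*-distribʳ-+ c (ℕtoℚ (a k)) (ℕtoℚ (sumℕ (map a ks))) ⟨
    (ℕtoℚ (a k) ℚ.+ ℕtoℚ (sumℕ (map a ks))) ℚ.* c
      ≡⟨ cong (ℚ._* c) (ℕtoℚ-+ (a k) (sumℕ (map a ks))) ⟨
    ℕtoℚ (a k ℕ.+ sumℕ (map a ks)) ℚ.* c
      ∎

  form-constant : ∀ x c → (∀ k → lookup x (ι k) ≡ c) → form x ≡ ℕtoℚ total ℚ.* c
  form-constant = partialForm-constant (allFin t)

  form-origin : form (origin n) ≡ 0ℚ
  form-origin = trans (form-constant (origin n) 0ℚ (λ k → VecP.lookup-replicate (ι k) 0ℚ)) (ℚP.*-zeroʳ (ℕtoℚ total))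

  -- ℓ takes every value B: at (B / a_k)·e_{ι k}, for any k with a_k ≠ 0
  level-point : ∀ B k → 1 ≤ a k → Σ (Pt n) λ x → form x ≡ B
  level-point B k ak≥1 = origin n [ ι k ]≔ β , (begin
    form (origin n [ ι k ]≔ β)
      ≡⟨ slope-update form-slopes (origin n) (ι k) β ⟩
    form (origin n) ℚ.+ ℕtoℚ (coeff (ι k)) ℚ.* (β ℚ.- lookup (origin n) (ι k))
      ≡⟨ cong₂ (λ F c → F ℚ.+ ℕtoℚ c ℚ.* (β ℚ.- lookup (origin n) (ι k))) form-origin (coeff-ι k) ⟩
    0ℚ ℚ.+ A ℚ.* (β ℚ.- lookup (origin n) (ι k))
      ≡⟨ cong (λ y → 0ℚ ℚ.+ A ℚ.* (β ℚ.- y)) (VecP.lookup-replicate (ι k) 0ℚ) ⟩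
    0ℚ ℚ.+ A ℚ.* (β ℚ.- 0ℚ)
      ≡⟨ solve 3 (λ A B I → con 0ℚ :+ A :* (B :* I :- con 0ℚ) := B :* (A :* I)) refl A B (ℚ.1/ A) ⟩
    B ℚ.* (A ℚ.* ℚ.1/ A)
      ≡⟨ cong (B ℚ.*_) (ℚP.*-inverseʳ A) ⟩
    B ℚ.* 1ℚ
      ≡⟨ ℚP.*-identityʳ B ⟩
    B ∎)
    where
    A = ℕtoℚ (a k)
    instance
      A≢0 : ℚ.NonZero A
      A≢0 = ℚ.≢-nonZero λ A≡0 → ℕP.<⇒≢ ak≥1 (sym (ℕtoℚ-injective (trans A≡0 (sym ℕtoℚ-zero))))
    β = B ℚ.* ℚ.1/ A

  CoeffInvariant : Permutation′ n → Set
  CoeffInvariant π = ∀ m → coeff (π ⟨$⟩ʳ m) ≡ coeff m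

  coeffInvariant-inverse : ∀ π → CoeffInvariant π → ∀ m → coeff (π ⟨$⟩ˡ m) ≡ coeff m
  coeffInvariant-inverse π invariant m = trans (sym (invariant (π ⟨$⟩ˡ m))) (cong coeff (inverseʳ π))

  ConstSign : (Fin n → Sign) → Sign → Set
  ConstSign s ε = ∀ (i : Fin t) → s (ι i) ≡ ε

  SignCondition : ℕ → (Fin n → Sign) → Set
  SignCondition b s = ConstSign s Sign.+ ⊎ (total ≡ 2 ℕ.* b × ConstSign s Sign.-)

  -- ℓ(w 0) when the signs on the first t coordinates equal ε
  offset : Sign → ℚ
  offset ε = ℕtoℚ total ℚ.* signMap ε 0ℚ

  conjugated-slopes : ∀ π s ε → CoeffInvariant π → ConstSign s ε → ∀ m →
    ℕtoℚ (coeff (π ⟨$⟩ˡ m)) ℚ.* signSlope (s (π ⟨$⟩ˡ m)) ≡ signSlope ε ℚ.* ℕtoℚ (coeff m)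
  conjugated-slopes π s ε invariant constant m = by-view (coordinate-view (π ⟨$⟩ˡ m))
    where
    by-view : Σ (Fin t) (λ k → ι k ≡ π ⟨$⟩ˡ m) ⊎ t ≤ toℕ (π ⟨$⟩ˡ m) →
      ℕtoℚ (coeff (π ⟨$⟩ˡ m)) ℚ.* signSlope (s (π ⟨$⟩ˡ m)) ≡ signSlope ε ℚ.* ℕtoℚ (coeff m)
    by-view (inj₁ (k , ιk≡π⁻¹m)) = begin
      ℕtoℚ (coeff (π ⟨$⟩ˡ m)) ℚ.* signSlope (s (π ⟨$⟩ˡ m))
        ≡⟨ cong₂ (λ c σ → ℕtoℚ c ℚ.* signSlope σ) (coeffInvariant-inverse π invariant m)
                                                  (trans (cong s (sym ιk≡π⁻¹m)) (constant k)) ⟩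
      ℕtoℚ (coeff m) ℚ.* signSlope ε
        ≡⟨ ℚP.*-comm (ℕtoℚ (coeff m)) (signSlope ε) ⟩
      signSlope ε ℚ.* ℕtoℚ (coeff m) ∎
    by-view (inj₂ beyond) = begin
      ℕtoℚ (coeff (π ⟨$⟩ˡ m)) ℚ.* signSlope (s (π ⟨$⟩ˡ m))
        ≡⟨ cong (λ c → ℕtoℚ c ℚ.* signSlope (s (π ⟨$⟩ˡ m))) (coeff-beyond (π ⟨$⟩ˡ m) beyond) ⟩
      ℕtoℚ 0 ℚ.* signSlope (s (π ⟨$⟩ˡ m))  ≡⟨ cong (ℚ._* signSlope (s (π ⟨$⟩ˡ m))) ℕtoℚ-zero ⟩
      0ℚ ℚ.* signSlope (s (π ⟨$⟩ˡ m))      ≡⟨ ℚP.*-zeroˡ (signSlope (s (π ⟨$⟩ˡ m))) ⟩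
      0ℚ                                   ≡⟨ ℚP.*-zeroʳ (signSlope ε) ⟨
      signSlope ε ℚ.* 0ℚ                   ≡⟨ cong (signSlope ε ℚ.*_) ℕtoℚ-zero ⟨
      signSlope ε ℚ.* ℕtoℚ 0               ≡⟨ cong (λ c → signSlope ε ℚ.* ℕtoℚ c) coeff-m≡0 ⟨
      signSlope ε ℚ.* ℕtoℚ (coeff m)   ∎
      where
      coeff-m≡0 : coeff m ≡ 0
      coeff-m≡0 = trans (sym (coeffInvariant-inverse π invariant m)) (coeff-beyond (π ⟨$⟩ˡ m) beyond)

  -- ℓ(w 0) = offset ε, since w 0 has all first t coordinates equal to signMap ε 0.
  conjugated-origin : ∀ π s ε → ConstSign s ε →
    form (act (π , s) (origin n)) ≡ offset ε ℚ.+ signSlope ε ℚ.* form (origin n)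
  conjugated-origin π s ε constant = begin
    form (act (π , s) (origin n))                ≡⟨ form-constant (act (π , s) (origin n)) (signMap ε 0ℚ) image-constant ⟩
    offset ε                                     ≡⟨ ℚP.+-identityʳ (offset ε) ⟨
    offset ε ℚ.+ 0ℚ                              ≡⟨ cong (offset ε ℚ.+_) (ℚP.*-zeroʳ (signSlope ε)) ⟨
    offset ε ℚ.+ signSlope ε ℚ.* 0ℚ              ≡⟨ cong (λ y → offset ε ℚ.+ signSlope ε ℚ.* y) form-origin ⟨
    offset ε ℚ.+ signSlope ε ℚ.* form (origin n) ∎
    where
    image-constant : ∀ k → lookup (act (π , s) (origin n)) (ι k) ≡ signMap ε 0ℚ
    image-constant k = trans (act-lookup π s (origin n) (ι k))
      (cong₂ signMap (constant k) (VecP.lookup-replicate (π ⟨$⟩ʳ ι k) 0ℚ))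

  conjugation-formula : ∀ π s ε → CoeffInvariant π → ConstSign s ε → ∀ x →
    form (act (π , s) x) ≡ offset ε ℚ.+ signSlope ε ℚ.* form x
  conjugation-formula π s ε invariant constant =
    affine-relation form-slopes (act-slopes π s form-slopes) (offset ε) (signSlope ε)
      (conjugated-slopes π s ε invariant constant) (origin n) (conjugated-origin π s ε constant)

  offset-fixes⇒signCondition : ∀ b s ε → ConstSign s ε →
    offset ε ℚ.+ signSlope ε ℚ.* ℕtoℚ b ≡ ℕtoℚ b → SignCondition b s
  offset-fixes⇒signCondition b s Sign.+ constant _     = inj₁ constant
  offset-fixes⇒signCondition b s Sign.- constant fixes = inj₂ (ℕtoℚ-injective (begin
    ℕtoℚ total
      ≡⟨ solve 2 (λ T B → T := (T :* (con 1ℚ :- con 0ℚ) :+ (:- con 1ℚ) :* B) :+ B) refl (ℕtoℚ total) (ℕtoℚ b) ⟩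
    (offset Sign.- ℚ.+ signSlope Sign.- ℚ.* ℕtoℚ b) ℚ.+ ℕtoℚ b
      ≡⟨ cong (ℚ._+ ℕtoℚ b) fixes ⟩
    ℕtoℚ b ℚ.+ ℕtoℚ b
      ≡⟨ ℕtoℚ-double b ⟨
    ℕtoℚ (2 ℕ.* b) ∎) , constant)

  signCondition⇒offset-fixes : ∀ b s → SignCondition b s →
    Σ Sign λ ε → ConstSign s ε × offset ε ℚ.+ signSlope ε ℚ.* ℕtoℚ b ≡ ℕtoℚ b
  signCondition⇒offset-fixes b s (inj₁ constant) =
    Sign.+ , constant , solve 2 (λ T B → T :* con 0ℚ :+ con 1ℚ :* B := B) refl (ℕtoℚ total) (ℕtoℚ b)
  signCondition⇒offset-fixes b s (inj₂ (total≡2b , constant)) = Sign.- , constant , (begin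
    ℕtoℚ total ℚ.* (1ℚ ℚ.- 0ℚ) ℚ.+ (ℚ.- 1ℚ) ℚ.* ℕtoℚ b
      ≡⟨ cong (λ T → T ℚ.* (1ℚ ℚ.- 0ℚ) ℚ.+ (ℚ.- 1ℚ) ℚ.* ℕtoℚ b)
              (trans (cong ℕtoℚ total≡2b) (ℕtoℚ-double b)) ⟩
    (ℕtoℚ b ℚ.+ ℕtoℚ b) ℚ.* (1ℚ ℚ.- 0ℚ) ℚ.+ (ℚ.- 1ℚ) ℚ.* ℕtoℚ b
      ≡⟨ solve 1 (λ B → (B :+ B) :* (con 1ℚ :- con 0ℚ) :+ (:- con 1ℚ) :* B := B) refl (ℕtoℚ b) ⟩
    ℕtoℚ b ∎)

-- The stabiliser of H, in terms of the coefficient vector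

module Stabiliser {n t : ℕ} (t≤n : t ≤ n) (a : Fin t → ℕ) (b : ℕ)
                  (π : Permutation′ n) (s : Fin n → Sign) where
  open LinearForm t≤n a

  H : Subset n
  H = hyperplane t≤n a b

  -- If ℓ ∘ w = offset ε + ε·ℓ with offset ε + ε·b = b, then w(H) = H, since
  -- u ↦ offset ε + ε·u fixes b and is injective.
  conjugate⇒fixes : ∀ ε → (∀ x → form (act (π , s) x) ≡ offset ε ℚ.+ signSlope ε ℚ.* form x) →
    offset ε ℚ.+ signSlope ε ℚ.* ℕtoℚ b ≡ ℕtoℚ b → Fixes (π , s) H
  conjugate⇒fixes ε formula offset-fixed = into , onto
    where
    into : ∀ x → H x → H (act (π , s) x)
    into x x∈H = begin
      form (act (π , s) x)                     ≡⟨ formula x ⟩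
      offset ε ℚ.+ signSlope ε ℚ.* form x      ≡⟨ cong (λ y → offset ε ℚ.+ signSlope ε ℚ.* y) x∈H ⟩
      offset ε ℚ.+ signSlope ε ℚ.* ℕtoℚ b      ≡⟨ offset-fixed ⟩
      ℕtoℚ b                                   ∎
    onto : ∀ y → H y → Σ (Pt n) λ x → H x × act (π , s) x ≡ y
    onto y y∈H = act-inverse (π , s) y , preimage∈H , act-inverse-right (π , s) y
      where
      preimage∈H : H (act-inverse (π , s) y)
      preimage∈H = signAffine-injective ε (offset ε) (form (act-inverse (π , s) y)) (ℕtoℚ b) (begin
        offset ε ℚ.+ signSlope ε ℚ.* form (act-inverse (π , s) y)  ≡⟨ formula (act-inverse (π , s) y) ⟨
        form (act (π , s) (act-inverse (π , s) y))                 ≡⟨ cong form (act-inverse-right (π , s) y) ⟩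
        form y                                                     ≡⟨ y∈H ⟩
        ℕtoℚ b                                                     ≡⟨ offset-fixed ⟨
        offset ε ℚ.+ signSlope ε ℚ.* ℕtoℚ b                        ∎)

  invariant⇒fixes : CoeffInvariant π → SignCondition b s → Fixes (π , s) H
  invariant⇒fixes invariant condition = from-signs (signCondition⇒offset-fixes b s condition)
    where
    from-signs : Σ Sign (λ ε → ConstSign s ε × offset ε ℚ.+ signSlope ε ℚ.* ℕtoℚ b ≡ ℕtoℚ b) → Fixes (π , s) H
    from-signs (ε , constant , offset-fixed) =
      conjugate⇒fixes ε (conjugation-formula π s ε invariant constant) offset-fixed

  -- The slopes c(π⁻¹ m)·σ_{π⁻¹ m} of ℓ ∘ w are proportional to c; written over ℕ,
  -- relative to a coordinate z: c(π⁻¹ z)·c m·σ_{π⁻¹ z} = c(π⁻¹ m)·c z·σ_{π⁻¹ m}.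
  proportional-slopes : (∀ x → H x → H (act (π , s) x)) → ∀ x₀ → H x₀ → ∀ z m →
    ℕtoℚ (coeff (π ⟨$⟩ˡ z) ℕ.* coeff m) ℚ.* signSlope (s (π ⟨$⟩ˡ z))
      ≡ ℕtoℚ (coeff (π ⟨$⟩ˡ m) ℕ.* coeff z) ℚ.* signSlope (s (π ⟨$⟩ˡ m))
  proportional-slopes into x₀ x₀∈H z m = begin
    ℕtoℚ (coeff (π ⟨$⟩ˡ z) ℕ.* coeff m) ℚ.* signSlope (s (π ⟨$⟩ˡ z))
      ≡⟨ cong (ℚ._* signSlope (s (π ⟨$⟩ˡ z))) (ℕtoℚ-* (coeff (π ⟨$⟩ˡ z)) (coeff m)) ⟩
    ℕtoℚ (coeff (π ⟨$⟩ˡ z)) ℚ.* ℕtoℚ (coeff m) ℚ.* signSlope (s (π ⟨$⟩ˡ z))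
      ≡⟨ swap (ℕtoℚ (coeff (π ⟨$⟩ˡ z))) (ℕtoℚ (coeff m)) (signSlope (s (π ⟨$⟩ˡ z))) ⟩
    ℕtoℚ (coeff (π ⟨$⟩ˡ z)) ℚ.* signSlope (s (π ⟨$⟩ˡ z)) ℚ.* ℕtoℚ (coeff m)
      ≡⟨ level-set-slopes form-slopes (act-slopes π s form-slopes) (ℕtoℚ b) into x₀ x₀∈H z m ⟩
    ℕtoℚ (coeff (π ⟨$⟩ˡ m)) ℚ.* signSlope (s (π ⟨$⟩ˡ m)) ℚ.* ℕtoℚ (coeff z)
      ≡⟨ swap (ℕtoℚ (coeff (π ⟨$⟩ˡ m))) (signSlope (s (π ⟨$⟩ˡ m))) (ℕtoℚ (coeff z)) ⟩
    ℕtoℚ (coeff (π ⟨$⟩ˡ m)) ℚ.* ℕtoℚ (coeff z) ℚ.* signSlope (s (π ⟨$⟩ˡ m))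
      ≡⟨ cong (ℚ._* signSlope (s (π ⟨$⟩ˡ m))) (ℕtoℚ-* (coeff (π ⟨$⟩ˡ m)) (coeff z)) ⟨
    ℕtoℚ (coeff (π ⟨$⟩ˡ m) ℕ.* coeff z) ℚ.* signSlope (s (π ⟨$⟩ˡ m)) ∎
    where
    swap : ∀ p q r → p ℚ.* q ℚ.* r ≡ p ℚ.* r ℚ.* q
    swap = solve 3 (λ p q r → p :* q :* r := p :* r :* q) refl

  -- Compare with the coordinate z = ι kmin of least positive
  -- coefficient: π cannot rescale c, and where c ≠ 0 the signs agree with σ_{π⁻¹ z}.
  fixes⇒invariant : (kmin kmax : Fin t) → (∀ k → 1 ≤ a k) → (∀ k → a kmin ≤ a k) → (∀ k → a k ≤ a kmax) →
    (∀ x → H x → H (act (π , s) x)) → CoeffInvariant π × SignCondition b s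
  fixes⇒invariant kmin kmax positive least largest into =
    from-point (level-point (ℕtoℚ b) kmin (positive kmin))
    where
    z = ι kmin
    coeff-z-positive : 1 ≤ coeff z
    coeff-z-positive = subst (1 ≤_) (sym (coeff-ι kmin)) (positive kmin)
    from-point : Σ (Pt n) (λ x → form x ≡ ℕtoℚ b) → CoeffInvariant π × SignCondition b s
    from-point (x₀ , x₀∈H) = invariant , offset-fixes⇒signCondition b s ε constant offset-fixed
      where
      signed : ∀ m → ℕtoℚ (coeff (π ⟨$⟩ˡ z) ℕ.* coeff m) ℚ.* signSlope (s (π ⟨$⟩ˡ z))
                   ≡ ℕtoℚ (coeff (π ⟨$⟩ˡ m) ℕ.* coeff z) ℚ.* signSlope (s (π ⟨$⟩ˡ m))
      signed = proportional-slopes into x₀ x₀∈H z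
      separated : ∀ m → (coeff (π ⟨$⟩ˡ z) ℕ.* coeff m ≡ coeff (π ⟨$⟩ˡ m) ℕ.* coeff z)
                      × (coeff (π ⟨$⟩ˡ z) ℕ.* coeff m ≡ 0 ⊎ s (π ⟨$⟩ˡ z) ≡ s (π ⟨$⟩ˡ m))
      separated m = signed-injective (coeff (π ⟨$⟩ˡ z) ℕ.* coeff m) (coeff (π ⟨$⟩ˡ m) ℕ.* coeff z)
                                     (s (π ⟨$⟩ˡ z)) (s (π ⟨$⟩ˡ m)) (signed m)
      inverse-invariant : ∀ m → coeff (π ⟨$⟩ˡ m) ≡ coeff m
      inverse-invariant = rescaling-is-trivial coeff (flip π) z (ι kmax) coeff-z-positive
        (coeff-least kmin least) (coeff-largest kmax largest) (proj₁ ∘ separated)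
      invariant : CoeffInvariant π
      invariant m = trans (sym (inverse-invariant (π ⟨$⟩ʳ m))) (cong coeff (inverseˡ π))
      ε : Sign
      ε = s (π ⟨$⟩ˡ z)
      sign-agrees : ∀ m → 1 ≤ coeff m → s (π ⟨$⟩ˡ m) ≡ ε
      sign-agrees m positive-m = [ product-nonzero , sym ]′ (proj₂ (separated m))
        where
        coeff-π⁻¹z-positive : 1 ≤ coeff (π ⟨$⟩ˡ z)
        coeff-π⁻¹z-positive = subst (1 ≤_) (sym (inverse-invariant z)) coeff-z-positive
        product-nonzero : coeff (π ⟨$⟩ˡ z) ℕ.* coeff m ≡ 0 → s (π ⟨$⟩ˡ m) ≡ ε
        product-nonzero product≡0 = ⊥-elim (ℕP.<⇒≢ (ℕP.*-mono-≤ coeff-π⁻¹z-positive positive-m) (sym product≡0))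
      constant : ConstSign s ε
      constant k = trans (cong s (sym (inverseˡ π)))
        (sign-agrees (π ⟨$⟩ʳ ι k) (subst (1 ≤_) (sym (trans (invariant (ι k)) (coeff-ι k))) (positive k)))
      offset-fixed : offset ε ℚ.+ signSlope ε ℚ.* ℕtoℚ b ≡ ℕtoℚ b
      offset-fixed = begin
        offset ε ℚ.+ signSlope ε ℚ.* ℕtoℚ b    ≡⟨ cong (λ y → offset ε ℚ.+ signSlope ε ℚ.* y) x₀∈H ⟨
        offset ε ℚ.+ signSlope ε ℚ.* form x₀   ≡⟨ conjugation-formula π s ε invariant constant x₀ ⟨
        form (act (π , s) x₀)                  ≡⟨ into x₀ x₀∈H ⟩
        ℕtoℚ b                                 ∎

  fixes⇔invariant : (kmin kmax : Fin t) → (∀ k → 1 ≤ a k) → (∀ k → a kmin ≤ a k) → (∀ k → a k ≤ a kmax) →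
    Fixes (π , s) H ⇔ (CoeffInvariant π × SignCondition b s)
  fixes⇔invariant kmin kmax positive least largest =
    mk⇔ (fixes⇒invariant kmin kmax positive least largest ∘ proj₁) (uncurry invariant⇒fixes)

-- The blocks I_j of a sorted coefficient sequence

filter-length-≥ : ∀ {X : Set} {P : X → Set} (P? : Decidable P) {t} (g : Fin t → X) r → r < t →
  (∀ k → toℕ k ≤ r → P (g k)) → suc r ≤ length (filter P? (List.tabulate g))
filter-length-≥ P? {suc t} g r r<t prefix with P? (g Fin.zero)
... | no ¬p = ⊥-elim (¬p (prefix Fin.zero z≤n))
filter-length-≥ P? {suc t} g zero    r<t       prefix | yes _ = s≤s z≤n
filter-length-≥ P? {suc t} g (suc r) (s≤s r<t) prefix | yes _ =
  s≤s (filter-length-≥ P? (g ∘ Fin.suc) r r<t (λ k k≤r → prefix (Fin.suc k) (s≤s k≤r)))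

filter-length-≤ : ∀ {X : Set} {P : X → Set} (P? : Decidable P) {t} (g : Fin t → X) r →
  (∀ k → r ≤ toℕ k → ¬ P (g k)) → length (filter P? (List.tabulate g)) ≤ r
filter-length-≤ P? {zero}  g r suffix = z≤n
filter-length-≤ P? {suc t} g r suffix with P? (g Fin.zero)
filter-length-≤ P? {suc t} g zero    suffix | yes p = ⊥-elim (suffix Fin.zero z≤n p)
filter-length-≤ P? {suc t} g (suc r) suffix | yes _ =
  s≤s (filter-length-≤ P? (g ∘ Fin.suc) r (λ k r≤k → suffix (Fin.suc k) (s≤s r≤k)))
filter-length-≤ P? {suc t} g zero    suffix | no _ =
  filter-length-≤ P? (g ∘ Fin.suc) zero (λ k _ → suffix (Fin.suc k) z≤n)
filter-length-≤ P? {suc t} g (suc r) suffix | no _ =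
  ℕP.m≤n⇒m≤1+n (filter-length-≤ P? (g ∘ Fin.suc) r (λ k r≤k → suffix (Fin.suc k) (s≤s r≤k)))

ℓ-largest : ∀ {t} (a : Fin t → ℕ) → (∀ i j → i ≤ᶠ j → a i ≤ a j) → (1≤t : 1 ≤ t) → ∀ k → a k ≤ ℓ 1≤t a
ℓ-largest {suc t} a mono _ k = mono k (Fin.fromℕ t) (FinP.≤fromℕ k)

module Blocks {t : ℕ} (a : Fin t → ℕ) (positive : ∀ k → 1 ≤ a k) (mono : ∀ i j → i ≤ᶠ j → a i ≤ a j) where

  -- the number of positions with value at most j; as a is sorted these are the first atMost j positions
  atMost : ℕ → ℕ
  atMost j = length (filter (λ k → a k ℕ.≤? j) (allFin t))

  split : ∀ j ks → length (filter (λ k → a k ℕ.≤? suc j) ks)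
                 ≡ length (filter (λ k → a k ℕ.≤? j) ks) ℕ.+ length (filter (λ k → a k ℕ.≟ suc j) ks)
  split j []       = refl
  split j (k ∷ ks) with a k ℕ.≤ᵇ suc j in ≤sj | a k ℕ.≤ᵇ j in ≤j | a k ℕ.≡ᵇ suc j in ≡sj
  ... | true  | true  | true  = ⊥-elim (ℕP.<-irrefl refl (subst (ℕ._≤ j) (≡ᵇ-true {a k} ≡sj) (≤ᵇ-true {a k} ≤j)))
  ... | true  | true  | false = cong suc (split j ks)
  ... | true  | false | true  = trans (cong suc (split j ks)) (sym (ℕP.+-suc _ _))
  ... | true  | false | false =
    ⊥-elim (≡ᵇ-false {a k} ≡sj (ℕP.≤-antisym (≤ᵇ-true {a k} ≤sj) (ℕP.≰⇒> (≤ᵇ-false {a k} ≤j))))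
  ... | false | true  | _     = ⊥-elim (≤ᵇ-false {a k} ≤sj (ℕP.m≤n⇒m≤1+n (≤ᵇ-true {a k} ≤j)))
  ... | false | false | true  = ⊥-elim (≤ᵇ-false {a k} ≤sj (ℕP.≤-reflexive (≡ᵇ-true {a k} ≡sj)))
  ... | false | false | false = split j ks

  -- α₁ + ⋯ + α_j counts the positions with value at most j (all values are ≥ 1)
  prefα≡atMost : ∀ j → prefα a j ≡ atMost j
  prefα≡atMost zero    = sym (ℕP.n≤0⇒n≡0 (filter-length-≤ (λ k → a k ℕ.≤? 0) (λ k → k) 0
                           (λ k _ ak≤0 → ℕP.<-irrefl refl (ℕP.≤-trans (positive k) ak≤0))))
  prefα≡atMost (suc j) = trans (cong (ℕ._+ α a (suc j)) (prefα≡atMost j)) (sym (split j (allFin t)))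

  below-atMost : ∀ k j → a k ≤ j → toℕ k < atMost j
  below-atMost k j ak≤j = filter-length-≥ (λ k → a k ℕ.≤? j) (λ k → k) (toℕ k) (FinP.toℕ<n k)
    (λ k′ k′≤k → ℕP.≤-trans (mono k′ k k′≤k) ak≤j)

  atMost-below : ∀ k j → ¬ a k ≤ j → atMost j ≤ toℕ k
  atMost-below k j ak≰j = filter-length-≤ (λ k → a k ℕ.≤? j) (λ k → k) (toℕ k)
    (λ k′ k≤k′ ak′≤j → ak≰j (ℕP.≤-trans (mono k k′ k≤k′) ak′≤j))

  atMost≤t : ∀ j → atMost j ≤ t
  atMost≤t j = ℕP.≤-trans (ListP.length-filter (λ k → a k ℕ.≤? j) (allFin t))
                          (ℕP.≤-reflexive (ListP.length-tabulate (λ k → k)))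

  InI⇒value : ∀ j k → InI a j (toℕ k) → a k ≡ j
  InI⇒value (suc j) k (from , below) with a k ℕ.≤? suc j | a k ℕ.≤? j
  ... | _         | yes ak≤j = ⊥-elim (ℕP.<⇒≱ (below-atMost k j ak≤j) (subst (_≤ toℕ k) (prefα≡atMost j) from))
  ... | no ak≰sj  | no _     =
    ⊥-elim (ℕP.<⇒≱ below (subst (_≤ toℕ k) (sym (prefα≡atMost (suc j))) (atMost-below k (suc j) ak≰sj)))
  ... | yes ak≤sj | no ak≰j  = ℕP.≤-antisym ak≤sj (ℕP.≰⇒> ak≰j)

  value⇒InI : ∀ j k → 1 ≤ j → a k ≡ j → InI a j (toℕ k)
  value⇒InI (suc j) k _ ak≡sj =
    subst (_≤ toℕ k) (sym (prefα≡atMost j)) (atMost-below k j λ ak≤j → ℕP.<-irrefl refl (subst (ℕ._≤ j) ak≡sj ak≤j)) ,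
    subst (toℕ k <_) (sym (prefα≡atMost (suc j))) (below-atMost k (suc j) (ℕP.≤-reflexive ak≡sj))

  InI⇒below-t : ∀ j r → InI a j r → r < t
  InI⇒below-t (suc j) r (_ , below) = ℕP.≤-trans below (subst (_≤ t) (sym (prefα≡atMost (suc j))) (atMost≤t (suc j)))

inPB⇔invariant : ∀ {n t} (t≤n : t ≤ n) (1≤t : 1 ≤ t) (a : Fin t → ℕ) (b : ℕ) →
  (∀ k → 1 ≤ a k) → (∀ i j → i ≤ᶠ j → a i ≤ a j) → (π : Permutation′ n) (s : Fin n → Sign) →
  InPB t≤n 1≤t a b (π , s) ⇔ (LinearForm.CoeffInvariant t≤n a π × LinearForm.SignCondition t≤n a b s)
inPB⇔invariant {n} {t} t≤n 1≤t a b positive mono π s =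
  mk⇔ (λ { (blocks , tail , signs) → blocks⇒invariant blocks tail , signs })
      (λ { (invariant , signs) → invariant⇒blocks invariant , invariant⇒tail invariant , signs })
  where
  open LinearForm t≤n a
  open Blocks a positive mono

  PreservesBlocks : Set
  PreservesBlocks = ∀ j → 1 ≤ j → j ≤ ℓ 1≤t a → ∀ (i : Fin t) → InI a j (toℕ i) → InI a j (toℕ (π ⟨$⟩ʳ ι i))

  PreservesTail : Set
  PreservesTail = ∀ (m : Fin n) → t ≤ toℕ m → t ≤ toℕ (π ⟨$⟩ʳ m)

  blocks⇒invariant : PreservesBlocks → PreservesTail → CoeffInvariant π
  blocks⇒invariant blocks tail m with coordinate-view m
  ... | inj₂ beyond = trans (coeff-beyond _ (tail m beyond)) (sym (coeff-beyond m beyond))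
  ... | inj₁ (k , refl) = begin
    coeff (π ⟨$⟩ʳ ι k)  ≡⟨ cong coeff (proj₂ found) ⟨
    coeff (ι k′)        ≡⟨ coeff-ι k′ ⟩
    a k′                ≡⟨ InI⇒value (a k) k′ k′∈Iak ⟩
    a k                 ≡⟨ coeff-ι k ⟨
    coeff (ι k)         ∎
    where
    moved : InI a (a k) (toℕ (π ⟨$⟩ʳ ι k))
    moved = blocks (a k) (positive k) (ℓ-largest a mono 1≤t k) k (value⇒InI (a k) k (positive k) refl)
    found = ι-onto (π ⟨$⟩ʳ ι k) (InI⇒below-t (a k) _ moved)
    k′ = proj₁ found
    k′∈Iak : InI a (a k) (toℕ k′)
    k′∈Iak = subst (InI a (a k)) (trans (cong toℕ (sym (proj₂ found))) (toℕ-ι k′)) moved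

  invariant⇒blocks : CoeffInvariant π → PreservesBlocks
  invariant⇒blocks invariant j 1≤j _ i i∈Ij = subst (InI a j) (trans (sym (toℕ-ι k′)) (cong toℕ (proj₂ found)))
    (value⇒InI j k′ 1≤j (begin
      a k′                ≡⟨ coeff-ι k′ ⟨
      coeff (ι k′)        ≡⟨ cong coeff (proj₂ found) ⟩
      coeff (π ⟨$⟩ʳ ι i)  ≡⟨ image-coeff ⟩
      a i                 ≡⟨ InI⇒value j i i∈Ij ⟩
      j                   ∎))
    where
    image-coeff : coeff (π ⟨$⟩ʳ ι i) ≡ a i
    image-coeff = trans (invariant (ι i)) (coeff-ι i)
    found = coeff-positive⇒ι (π ⟨$⟩ʳ ι i) (subst (1 ≤_) (sym image-coeff) (positive i))
    k′ = proj₁ found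

  invariant⇒tail : CoeffInvariant π → PreservesTail
  invariant⇒tail invariant m beyond with coordinate-view (π ⟨$⟩ʳ m)
  ... | inj₂ beyond′   = beyond′
  ... | inj₁ (k , ιk≡πm) = ⊥-elim (ℕP.<⇒≢ (positive k) (begin
    0                   ≡⟨ coeff-beyond m beyond ⟨
    coeff m             ≡⟨ invariant m ⟨
    coeff (π ⟨$⟩ʳ m)    ≡⟨ cong coeff ιk≡πm ⟨
    coeff (ι k)         ≡⟨ coeff-ι k ⟩
    a k                 ∎))

-- Theorem 5.2: F(H) = P(H) × B_{n,t}.  Both sides are equivalent to "c ∘ π = c
-- and the sign condition"; the extreme coefficients are a₁ (first) and a_t (last).

theorem5p2 : (n t : ℕ) → (1≤t : 1 ≤ t) → (t≤n : t ≤ n) → (a : Fin t → ℕ) → (b : ℕ)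
    → (∀ i → 1 ≤ a i) → (∀ i j → i ≤ᶠ j → a i ≤ a j) → 1 ≤ b
    → Spanned (hyperplane t≤n a b)
    → (w : SignedPerm n)
    → Fixes w (hyperplane t≤n a b) ⇔ InPB t≤n 1≤t a b w
theorem5p2 n zero    ()
theorem5p2 n (suc t) 1≤t t≤n a b positive mono _ _ (π , s) =
  Equivalence.trans
    (Stabiliser.fixes⇔invariant t≤n a b π s Fin.zero (Fin.fromℕ t) positive
       (λ k → mono Fin.zero k z≤n) (ℓ-largest a mono 1≤t))
    (Equivalence.sym (inPB⇔invariant t≤n 1≤t a b positive mono π s))
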